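{- Let $D$ be a digraph and let $S$ be the set of all sources and all sinks of $D$. Then \[\operatorname{bw}(u(D))-|S|\;\leq\;\operatorname{dbw}(D)\;\leq\;\operatorname{bw}(u(D)).\]
   Context: All digraphs are finite; $u(D)$ is the underlying undirected graph of $D$. A source is a vertex of in-degree $0$ and a sink a vertex of out-degree $0$. Branch-width: a branch decomposition of an undirected graph $G$ is a pair $(T,\tau)$ with $T$ a tree of maximum degree at most three and $\tau$ a bijection from the leaves of $T$ to $E(G)$. The order of an edge $e$ of $T$ is the number of vertices $v$ of $G$ for which there are leaves $t_1,t_2$ in different components of $T-e$ with $\tau(t_1),\tau(t_2)$ both incident with $v$. The width is the maximum order of an edge, and $\operatorname{bw}(G)$ is the minimum width. Directed branch-width: for $B\subseteq E(D)$ let $S_B^V=\{y\in V(D): \exists x,z \text{ with } \vec{xy}\in E(D)\setminus B,\ \vec{yz}\in B\}$ and $f_D(X)=|S_X^V\cup S_{E(D)\setminus X}^V|$. A directed branch decomposition is a pair $(T,\beta)$ with $T$ a tree of maximum degree at most three and $\beta$ a bijection from the leaves of $T$ to $E(D)$. For an edge $xy$ of $T$, with $Y$ the set of leaves in the component of $T-xy$ containing $y$, its order is $f_D(\beta(Y))$. The width is the maximum order of an edge, and $\operatorname{dbw}(D)$ is the minimum width. -}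

module Defs where

open import Data.Nat using (ℕ; zero; suc; _+_; _≤_)
open import Data.Fin using (Fin; zero; suc; _≟_)
open import Data.Product using (Σ; _×_; _,_; proj₁; proj₂; ∃)
open import Data.Sum using (_⊎_)
open import Data.Unit using (⊤)
open import Data.List using (List; length)
open import Data.List.Relation.Unary.Unique.Propositional using (Unique)
open import Data.List.Membership.Propositional using (_∈_)
open import Relation.Nullary using (¬_; Dec; does)
open import Relation.Binary.PropositionalEquality using (_≡_)
open import Function.Bundles using (_⤖_; _⇔_; Bijection)
open import Data.Bool using (Bool; true; false)

Card : {n : ℕ} → (Fin n → Set) → ℕ → Set
Card {n} P c = Σ (List (Fin n)) λ l →
  Unique l × (length l ≡ c) × (∀ v → (P v ⇔ (v ∈ l)))

-- Finite digraphs (arcs indexed by Fin m; loops / parallel arcs allowed)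

record Digraph : Set where
  field
    n    : ℕ
    m    : ℕ
    tail : Fin m → Fin n
    head : Fin m → Fin n
open Digraph public

record Graph : Set where
  field
    n    : ℕ
    m    : ℕ
    ends : Fin m → Fin n × Fin n
open Graph public

u : Digraph → Graph
u D = record { n = n D ; m = m D ; ends = λ a → tail D a , head D a }

Incident : (G : Graph) → Fin (m G) → Fin (n G) → Set
Incident G i v = (proj₁ (ends G i) ≡ v) ⊎ (proj₂ (ends G i) ≡ v)

IsSource : (D : Digraph) → Fin (n D) → Set
IsSource D v = ∀ a → ¬ (head D a ≡ v)

IsSink : (D : Digraph) → Fin (n D) → Set
IsSink D v = ∀ a → ¬ (tail D a ≡ v)

SourceOrSink : (D : Digraph) → Fin (n D) → Set
SourceOrSink D v = IsSource D v ⊎ IsSink D v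

data Reach {k t : ℕ} (E : Fin t → Fin k × Fin k) (ok : Fin t → Set)
       : Fin k → Fin k → Set where
  here : ∀ {a} → Reach E ok a a
  fwd  : ∀ {a b} (i : Fin t) → ok i → proj₁ (E i) ≡ a →
         Reach E ok (proj₂ (E i)) b → Reach E ok a b
  bwd  : ∀ {a b} (i : Fin t) → ok i → proj₂ (E i) ≡ a →
         Reach E ok (proj₁ (E i)) b → Reach E ok a b

sumFin : {t : ℕ} → (Fin t → ℕ) → ℕ
sumFin {zero}  f = 0
sumFin {suc t} f = f zero + sumFin (λ i → f (suc i))

ind : {P : Set} → Dec P → ℕ
ind d with does d
... | true  = 1
... | false = 0

degree : {k t : ℕ} → (Fin t → Fin k × Fin k) → Fin k → ℕ
degree E v = sumFin (λ i → ind (proj₁ (E i) ≟ v) + ind (proj₂ (E i) ≟ v))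

-- A tree of maximum degree ≤ 3 whose leaves are in bijection with Fin m.
-- Tree = connected graph with (#vertices) = (#edges) + 1.
record BranchDecomp (m : ℕ) : Set₁ where
  field
    k         : ℕ
    t         : ℕ
    tedge     : Fin t → Fin k × Fin k
    connected : ∀ a b → Reach tedge (λ _ → ⊤) a b
    count     : t + 1 ≡ k
    maxdeg3   : ∀ v → degree tedge v ≤ 3
    bij       : (Σ (Fin k) λ v → degree tedge v ≤ 1) ⤖ Fin m
open BranchDecomp public

Leaf : {m : ℕ} → BranchDecomp m → Set
Leaf T = Σ (Fin (k T)) λ v → degree (tedge T) v ≤ 1

label : {m : ℕ} (T : BranchDecomp m) → Leaf T → Fin m
label T = Bijection.to (bij T)

-- the element a of E is placed at a leaf in the component of T - e containing node z
OnSide : {m : ℕ} (T : BranchDecomp m) (e : Fin (t T)) (z : Fin (k T)) → Fin m → Set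
OnSide T e z a = Σ (Leaf T) λ ℓ →
  (label T ℓ ≡ a) × Reach (tedge T) (λ i → ¬ (i ≡ e)) z (proj₁ ℓ)

BoundaryU : (G : Graph) (T : BranchDecomp (m G)) (e : Fin (t T)) → Fin (n G) → Set
BoundaryU G T e v =
  (∃ λ a → OnSide T e (proj₁ (tedge T e)) a × Incident G a v) ×
  (∃ λ b → OnSide T e (proj₂ (tedge T e)) b × Incident G b v)

WidthU≤ : (G : Graph) → BranchDecomp (m G) → ℕ → Set
WidthU≤ G T w = ∀ e → ∃ λ c → Card (BoundaryU G T e) c × c ≤ w

-- bw G ≡ w  (convention: 0 for an edgeless graph, where no decomposition exists)
IsBW : Graph → ℕ → Set₁
IsBW G w =
  ((m G ≡ 0) × (w ≡ 0)) ⊎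
  ((Σ (BranchDecomp (m G)) λ T → WidthU≤ G T w) ×
   (∀ (T : BranchDecomp (m G)) w' → WidthU≤ G T w' → w ≤ w'))

-- For e = xy of T, with Y = leaves on the y-side, X := β(Y) and E(D) ∖ X = arcs on the x-side.
-- S_X^V  = {v | some arc into v lies in E∖X, some arc out of v lies in X}
-- S_{E∖X}^V = {v | some arc into v lies in X, some arc out of v lies in E∖X}
S-side : (D : Digraph) (T : BranchDecomp (m D)) (e : Fin (t T))
         (zin zout : Fin (k T)) → Fin (n D) → Set
S-side D T e zin zout v =
  (∃ λ a → OnSide T e zin a × head D a ≡ v) ×
  (∃ λ b → OnSide T e zout b × tail D b ≡ v)

BoundaryD : (D : Digraph) (T : BranchDecomp (m D)) (e : Fin (t T)) → Fin (n D) → Set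
BoundaryD D T e v =
  S-side D T e (proj₁ (tedge T e)) (proj₂ (tedge T e)) v ⊎
  S-side D T e (proj₂ (tedge T e)) (proj₁ (tedge T e)) v

WidthD≤ : (D : Digraph) → BranchDecomp (m D) → ℕ → Set
WidthD≤ D T w = ∀ e → ∃ λ c → Card (BoundaryD D T e) c × c ≤ w

-- dbw D ≡ w  (convention: 0 when D has no arcs)
IsDBW : Digraph → ℕ → Set₁
IsDBW D w =
  ((m D ≡ 0) × (w ≡ 0)) ⊎
  ((Σ (BranchDecomp (m D)) λ T → WidthD≤ D T w) ×
   (∀ (T : BranchDecomp (m D)) w' → WidthD≤ D T w' → w ≤ w'))

-- Both widths are measured on the same decompositions, because the leaves are labelled by the
-- arcs of D, which are the edges of u(D). For each edge of the tree, the directed boundary is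
-- contained in the undirected one, giving dbw ≤ bw. Conversely, a vertex of the undirected
-- boundary that is neither a source nor a sink lies in the directed boundary, so each undirected
-- order exceeds the directed one by at most |S|, giving bw ≤ dbw + |S|. Counting the boundaries
-- constructively needs them decidable, which comes down to deciding reachability in the tree.
module Submission where

open import Defs
open import Data.Nat using (ℕ; suc; _+_; _≤_; z≤n)
open import Data.Nat.Properties using (≤-trans; +-monoˡ-≤)
open import Data.Product using (Σ; ∃; _×_; _,_; proj₁; proj₂)
open import Data.Sum using (_⊎_; inj₁; inj₂; [_,_])
open import Data.Empty using (⊥; ⊥-elim)
open import Data.Unit using (⊤)
open import Data.Fin using (Fin; zero; suc; _≟_)
open import Data.Fin.Properties using (any?; injective⇒≤)
open import Data.List using (List; []; _++_; length; lookup; filter; allFin)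
open import Data.List.Properties using (length-++)
open import Data.List.Membership.Propositional using (_∈_)
open import Data.List.Membership.Propositional.Properties using (∈-lookup; ∈-filter⁺; ∈-filter⁻; ∈-allFin; ∈-++⁺ˡ; ∈-++⁺ʳ)
open import Data.List.Membership.Setoid.Properties using (index-injective)
open import Data.List.Relation.Unary.All using () renaming (lookup to All-lookup)
open import Data.List.Relation.Unary.AllPairs using ([]; _∷_)
open import Data.List.Relation.Unary.Unique.Propositional using (Unique)
open import Data.List.Relation.Unary.Unique.Propositional.Properties using (filter⁺; allFin⁺)
open import Relation.Nullary using (¬_; Dec; yes; no; contradiction)
open import Relation.Nullary.Decidable using (map′; ¬?; _×-dec_; _⊎-dec_)
open import Relation.Binary using (Rel; Decidable)
open import Relation.Binary.Construct.Closure.ReflexiveTransitive using (Star; ε; _◅_; _◅◅_)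
open import Relation.Binary.PropositionalEquality using (_≡_; refl; sym; cong; subst; setoid)
open import Function.Bundles using (mk⇔; Equivalence; Bijection; Surjection)
open import Level using (0ℓ)

module _ {A : Set} where

  lookup-injective : ∀ {xs : List A} → Unique xs → ∀ {i j} → lookup xs i ≡ lookup xs j → i ≡ j
  lookup-injective (_ ∷ _)  {zero}  {zero}  _  = refl
  lookup-injective (x≢ ∷ _) {zero}  {suc j} eq = contradiction eq (All-lookup x≢ (∈-lookup j))
  lookup-injective (x≢ ∷ _) {suc i} {zero}  eq = contradiction (sym eq) (All-lookup x≢ (∈-lookup i))
  lookup-injective (_ ∷ u)  {suc i} {suc j} eq = cong suc (lookup-injective u eq)

  length-mono-⊆ : ∀ {xs ys : List A} → Unique xs → (∀ {v} → v ∈ xs → v ∈ ys) → length xs ≤ length ys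
  length-mono-⊆ u xs⊆ys = injective⇒≤ λ eq →
    lookup-injective u (index-injective (setoid A) (xs⊆ys (∈-lookup _)) (xs⊆ys (∈-lookup _)) eq)

card-dec : ∀ {n} {P : Fin n → Set} → (∀ v → Dec (P v)) → Σ ℕ (Card P)
card-dec {n} P? = _ , filter P? (allFin n) , filter⁺ P? (allFin⁺ n) , refl ,
  λ v → mk⇔ (∈-filter⁺ P? (∈-allFin v)) (λ v∈ → proj₂ (∈-filter⁻ P? {xs = allFin n} v∈))

card≤length : ∀ {n} {P : Fin n → Set} {c} {ys : List (Fin n)} →
              Card P c → (∀ v → P v → v ∈ ys) → c ≤ length ys
card≤length (xs , u , refl , P⇔∈xs) P⊆ys =
  length-mono-⊆ u (λ {v} v∈xs → P⊆ys v (Equivalence.from (P⇔∈xs v) v∈xs))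

card-mono : ∀ {n} {P Q : Fin n → Set} {c d} →
            Card P c → Card Q d → (∀ v → P v → Q v) → c ≤ d
card-mono cP (ys , _ , refl , Q⇔∈ys) P⊆Q =
  card≤length cP (λ v p → Equivalence.to (Q⇔∈ys v) (P⊆Q v p))

card-⊎ : ∀ {n} {P Q R : Fin n → Set} {c d e} → Card P c → Card Q d → Card R e →
         (∀ v → P v → Q v ⊎ R v) → c ≤ d + e
card-⊎ cP (ys , _ , refl , Q⇔∈ys) (zs , _ , refl , R⇔∈zs) P⊆Q∪R =
  subst (_ ≤_) (length-++ ys) (card≤length {ys = ys ++ zs} cP λ v p →
    [ (λ q → ∈-++⁺ˡ (Equivalence.to (Q⇔∈ys v) q))
    , (λ r → ∈-++⁺ʳ ys (Equivalence.to (R⇔∈zs v) r))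
    ] (P⊆Q∪R v p))

card-⊥ : ∀ {n} → Card {n} (λ _ → ⊥) 0
card-⊥ = [] , [] , refl , λ v → mk⇔ ⊥-elim (λ ())

module EliminateZero {k : ℕ} (R : Rel (Fin (suc k)) 0ℓ) where

  R₀ : Rel (Fin k) 0ℓ
  R₀ a b = R (suc a) (suc b) ⊎ (R (suc a) zero × R zero (suc b))

  R₀? : Decidable R → Decidable R₀
  R₀? R? a b = R? (suc a) (suc b) ⊎-dec (R? (suc a) zero ×-dec R? zero (suc b))

  lift : ∀ {a b} → Star R₀ a b → Star R (suc a) (suc b)
  lift ε                    = ε
  lift (inj₁ r ◅ p)         = r ◅ lift p
  lift (inj₂ (r , r′) ◅ p)  = r ◅ r′ ◅ lift p

  lower     : ∀ {a b} → Star R (suc a) (suc b) → Star R₀ a b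
  lowerFrom : ∀ {b} → Star R zero (suc b) → ∃ λ c → R zero (suc c) × Star R₀ c b
  lower ε = ε
  lower (_◅_ {j = suc c} r p) = inj₁ r ◅ lower p
  lower (_◅_ {j = zero}  r p) with lowerFrom p
  ... | c , r′ , q = inj₂ (r , r′) ◅ q
  lowerFrom (_◅_ {j = zero}  _ p) = lowerFrom p
  lowerFrom (_◅_ {j = suc c} r p) = c , r , lower p

  lowerTo : ∀ {a} → Star R (suc a) zero → ∃ λ c → Star R₀ a c × R (suc c) zero
  lowerTo (_◅_ {j = zero}  r _) = _ , ε , r
  lowerTo (_◅_ {j = suc c} r p) with lowerTo p
  ... | c′ , q , r′ = c′ , inj₁ r ◅ q , r′

-- R-paths between nonzero vertices are exactly R₀-paths, R₀ adding the detours through zero.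
Star? : ∀ {k} (R : Rel (Fin k) 0ℓ) → Decidable R → Decidable (Star R)
Star? {suc k} R R? zero    zero    = yes ε
Star? {suc k} R R? (suc a) (suc b) = map′ lift lower (Star? R₀ (R₀? R?) a b)
  where open EliminateZero R
Star? {suc k} R R? zero    (suc b) =
  map′ (λ (c , r , q) → r ◅ lift q) lowerFrom
       (any? λ c → R? zero (suc c) ×-dec Star? R₀ (R₀? R?) c b)
  where open EliminateZero R
Star? {suc k} R R? (suc a) zero    =
  map′ (λ (c , q , r) → lift q ◅◅ r ◅ ε) lowerTo
       (any? λ c → Star? R₀ (R₀? R?) a c ×-dec R? (suc c) zero)
  where open EliminateZero R

module _ {k t : ℕ} (E : Fin t → Fin k × Fin k) (ok : Fin t → Set) where

  Adjacent : Rel (Fin k) 0ℓ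
  Adjacent a b = ∃ λ i → ok i ×
    ((proj₁ (E i) ≡ a × proj₂ (E i) ≡ b) ⊎ (proj₂ (E i) ≡ a × proj₁ (E i) ≡ b))

  Reach⇒Star : ∀ {a b} → Reach E ok a b → Star Adjacent a b
  Reach⇒Star here             = ε
  Reach⇒Star (fwd i oi eq r)  = (i , oi , inj₁ (eq , refl)) ◅ Reach⇒Star r
  Reach⇒Star (bwd i oi eq r)  = (i , oi , inj₂ (eq , refl)) ◅ Reach⇒Star r

  Star⇒Reach : ∀ {a b} → Star Adjacent a b → Reach E ok a b
  Star⇒Reach ε                                     = here
  Star⇒Reach ((i , oi , inj₁ (eq , refl)) ◅ p)     = fwd i oi eq (Star⇒Reach p)
  Star⇒Reach ((i , oi , inj₂ (eq , refl)) ◅ p)     = bwd i oi eq (Star⇒Reach p)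

  Reach? : (∀ i → Dec (ok i)) → ∀ a b → Dec (Reach E ok a b)
  Reach? ok? a b = map′ Star⇒Reach Reach⇒Star (Star? Adjacent Adjacent? a b)
    where
    Adjacent? : Decidable Adjacent
    Adjacent? a b = any? λ i → ok? i ×-dec
      ((proj₁ (E i) ≟ a ×-dec proj₂ (E i) ≟ b) ⊎-dec (proj₂ (E i) ≟ a ×-dec proj₁ (E i) ≟ b))

module _ {r : ℕ} (T : BranchDecomp r) (e : Fin (t T)) where

  private
    x y : Fin (k T)
    x = proj₁ (tedge T e)
    y = proj₂ (tedge T e)

    Avoids-e : Fin (t T) → Set
    Avoids-e i = ¬ (i ≡ e)

    leafOf : Fin r → Leaf T
    leafOf = Bijection.to⁻ (bij T)

    label-leafOf : ∀ a → label T (leafOf a) ≡ a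
    label-leafOf = Surjection.to∘to⁻ (Bijection.surjection (bij T))

  OnSide? : ∀ z a → Dec (OnSide T e z a)
  OnSide? z a = map′ (λ z↝ℓ → leafOf a , label-leafOf a , z↝ℓ) from
    (Reach? (tedge T) Avoids-e (λ i → ¬? (i ≟ e)) z (proj₁ (leafOf a)))
    where
    from : OnSide T e z a → Reach (tedge T) Avoids-e z (proj₁ (leafOf a))
    from (ℓ , refl , z↝ℓ) = subst (λ ℓ′ → Reach (tedge T) Avoids-e z (proj₁ ℓ′))
      (Bijection.injective (bij T) (sym (label-leafOf (label T ℓ)))) z↝ℓ

  -- The part of a path after its last use of e avoids e and starts at an end of e.
  reach-split : ∀ {z b} → Reach (tedge T) (λ _ → ⊤) z b →
    Reach (tedge T) Avoids-e z b ⊎ Reach (tedge T) Avoids-e x b ⊎ Reach (tedge T) Avoids-e y b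
  reach-split here = inj₁ here
  reach-split (fwd i _ eq p) with reach-split p | i ≟ e
  ... | inj₁ q | yes refl = inj₂ (inj₂ q)
  ... | inj₁ q | no i≢e   = inj₁ (fwd i i≢e eq q)
  ... | inj₂ q | _        = inj₂ q
  reach-split (bwd i _ eq p) with reach-split p | i ≟ e
  ... | inj₁ q | yes refl = inj₂ (inj₁ q)
  ... | inj₁ q | no i≢e   = inj₁ (bwd i i≢e eq q)
  ... | inj₂ q | _        = inj₂ q

  OnSide-total : ∀ a → OnSide T e x a ⊎ OnSide T e y a
  OnSide-total a with reach-split (connected T x (proj₁ (leafOf a)))
  ... | inj₁ q          = inj₁ (leafOf a , label-leafOf a , q)
  ... | inj₂ (inj₁ q)   = inj₁ (leafOf a , label-leafOf a , q)
  ... | inj₂ (inj₂ q)   = inj₂ (leafOf a , label-leafOf a , q)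

module _ (G : Graph) (T : BranchDecomp (m G)) (e : Fin (t T)) where

  BoundaryU? : ∀ v → Dec (BoundaryU G T e v)
  BoundaryU? v = incidentOn? (proj₁ (tedge T e)) ×-dec incidentOn? (proj₂ (tedge T e))
    where
    incidentOn? : ∀ z → Dec (∃ λ a → OnSide T e z a × Incident G a v)
    incidentOn? z = any? λ a → OnSide? T e z a ×-dec
      (proj₁ (ends G a) ≟ v ⊎-dec proj₂ (ends G a) ≟ v)

module _ (D : Digraph) (T : BranchDecomp (m D)) (e : Fin (t T)) where

  private
    x y : Fin (k T)
    x = proj₁ (tedge T e)
    y = proj₂ (tedge T e)

  BoundaryD? : ∀ v → Dec (BoundaryD D T e v)
  BoundaryD? v = S-side? x y ⊎-dec S-side? y x
    where
    S-side? : ∀ zin zout → Dec (S-side D T e zin zout v)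
    S-side? zin zout = (any? λ a → OnSide? T e zin a ×-dec head D a ≟ v)
                 ×-dec (any? λ b → OnSide? T e zout b ×-dec tail D b ≟ v)

  BoundaryD⊆BoundaryU : ∀ v → BoundaryD D T e v → BoundaryU (u D) T e v
  BoundaryD⊆BoundaryU v (inj₁ ((a , a∈x , ha) , (b , b∈y , tb))) =
    (a , a∈x , inj₂ ha) , (b , b∈y , inj₁ tb)
  BoundaryD⊆BoundaryU v (inj₂ ((a , a∈y , ha) , (b , b∈x , tb))) =
    (b , b∈x , inj₁ tb) , (a , a∈y , inj₂ ha)

  -- A vertex that is neither source nor sink has an in-arc and an out-arc. If these lie on
  -- different sides of e we are done; otherwise the arc at v on the other side, whichever
  -- way it points, pairs with one of them.
  BoundaryU⊆BoundaryD∪SourceOrSink :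
    ∀ v → BoundaryU (u D) T e v → BoundaryD D T e v ⊎ SourceOrSink D v
  BoundaryU⊆BoundaryD∪SourceOrSink v ((a , a∈x , a∼v) , (b , b∈y , b∼v))
    with any? (λ c → head D c ≟ v) | any? (λ c → tail D c ≟ v)
  ... | no ¬in | _       = inj₂ (inj₁ λ c hc → ¬in (c , hc))
  ... | yes _  | no ¬out = inj₂ (inj₂ λ c tc → ¬out (c , tc))
  ... | yes (cin , hin) | yes (cout , tout) with OnSide-total T e cin | OnSide-total T e cout
  ...   | inj₁ in∈x | inj₂ out∈y = inj₁ (inj₁ ((cin , in∈x , hin) , (cout , out∈y , tout)))
  ...   | inj₂ in∈y | inj₁ out∈x = inj₁ (inj₂ ((cin , in∈y , hin) , (cout , out∈x , tout)))
  ...   | inj₁ in∈x | inj₁ out∈x with b∼v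
  ...     | inj₁ tb = inj₁ (inj₁ ((cin , in∈x , hin) , (b , b∈y , tb)))
  ...     | inj₂ hb = inj₁ (inj₂ ((b , b∈y , hb) , (cout , out∈x , tout)))
  BoundaryU⊆BoundaryD∪SourceOrSink v ((a , a∈x , a∼v) , _)
    | yes (cin , hin) | yes (cout , tout) | inj₂ in∈y | inj₂ out∈y with a∼v
  ...     | inj₁ ta = inj₁ (inj₂ ((cin , in∈y , hin) , (a , a∈x , ta)))
  ...     | inj₂ ha = inj₁ (inj₁ ((a , a∈x , ha) , (cout , out∈y , tout)))

widthD≤widthU : ∀ D (T : BranchDecomp (m D)) w → WidthU≤ (u D) T w → WidthD≤ D T w
widthD≤widthU D T w widthU e with widthU e | card-dec (BoundaryD? D T e)
... | c , cardU , c≤w | c′ , cardD =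
  c′ , cardD , ≤-trans (card-mono cardD cardU (BoundaryD⊆BoundaryU D T e)) c≤w

widthU≤widthD+sourcesSinks : ∀ D (T : BranchDecomp (m D)) d s →
  WidthD≤ D T d → Card (SourceOrSink D) s → WidthU≤ (u D) T (d + s)
widthU≤widthD+sourcesSinks D T d s widthD cardS e
  with widthD e | card-dec (BoundaryU? (u D) T e)
... | c , cardD , c≤d | c′ , cardU =
  c′ , cardU ,
  ≤-trans (card-⊎ cardU cardD cardS (BoundaryU⊆BoundaryD∪SourceOrSink D T e)) (+-monoˡ-≤ s c≤d)

widthU-edgeless : ∀ G (T : BranchDecomp (m G)) → m G ≡ 0 → WidthU≤ G T 0
widthU-edgeless G T refl e with card-dec (BoundaryU? G T e)
... | c , cardU = c , cardU , card-mono cardU card-⊥ λ { v ((() , _) , _) }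

mainTheorem17 : (D : Digraph) (b d s : ℕ) →
    IsBW (u D) b → IsDBW D d → Card (SourceOrSink D) s →
    (b ≤ d + s) × (d ≤ b)
mainTheorem17 D b d s (inj₁ (_ , refl)) (inj₁ (_ , refl)) _ = z≤n , z≤n
mainTheorem17 D b d s (inj₁ (noArcs , refl)) (inj₂ ((T , _) , dbw-min)) _ =
  z≤n , dbw-min T 0 (widthD≤widthU D T 0 (widthU-edgeless (u D) T noArcs))
mainTheorem17 D b d s (inj₂ ((T , _) , bw-min)) (inj₁ (noArcs , refl)) _ =
  ≤-trans (bw-min T 0 (widthU-edgeless (u D) T noArcs)) z≤n , z≤n
mainTheorem17 D b d s (inj₂ ((Tb , widthTb) , bw-min)) (inj₂ ((Td , widthTd) , dbw-min)) cardS =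
  bw-min Td (d + s) (widthU≤widthD+sourcesSinks D Td d s widthTd cardS) ,
  dbw-min Tb b (widthD≤widthU D Tb b widthTb)
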